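{- Let $n\geq 1$ and $m\geq 1$ be integers. Then \[ \frac{1}{(n-1)!}\sum_{i=0}^{n}(-1)^{i}\binom{n}{i}\int_{0}^{n}(x-i)_{+}^{n-1}x^{m}\,dx=\frac{m!}{(m+n)!}\sum_{i=0}^{n}(-1)^{n-i}\binom{n}{i}i^{m+n}. \]
   Context: For real $x$, $x_{+}=\frac{x+|x|}{2}=\max(x,0)$, and $(x-i)_{+}^{n-1}$ is understood as $(x-i)^{n-1}$ for $x>i$ and $0$ for $x\le i$ (so that $\int_0^n (x-i)_+^{n-1}x^m\,dx=\int_i^n (x-i)^{n-1}x^m\,dx$). The convention $0^0=1$ is used in the sum on the right. -}

module Defs where

open import Data.Nat as ℕ using (ℕ; zero; suc; _!)
open import Data.Nat.Properties using (_!≢0)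
open import Data.Nat.Combinatorics using (_C_)
open import Data.Integer using (+_)
open import Data.List using (List; []; _∷_)
open import Data.Bool using (true; false)
open import Data.Rational using (ℚ; 0ℚ; 1ℚ; _+_; _*_; _-_; -_; _/_)

ℕtoℚ : ℕ → ℚ
ℕtoℚ n = + n / 1

_^ℚ_ : ℚ → ℕ → ℚ
q ^ℚ zero  = 1ℚ
q ^ℚ suc k = q * (q ^ℚ k)

Σ0to : ℕ → (ℕ → ℚ) → ℚ
Σ0to zero    f = f 0
Σ0to (suc n) f = Σ0to n f + f (suc n)

fact-ratio : ℕ → ℕ → ℚ
fact-ratio a b = (+ (a !)) / (b !)
  where instance _ = b !≢0

-- Polynomials with rational coefficients (ascending coefficient lists)

Poly : Set
Poly = List ℚ

padd : Poly → Poly → Poly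
padd []       q        = q
padd p        []       = p
padd (a ∷ p)  (b ∷ q)  = (a + b) ∷ padd p q

pscale : ℚ → Poly → Poly
pscale c []      = []
pscale c (a ∷ p) = (c * a) ∷ pscale c p

pmul : Poly → Poly → Poly
pmul []      q = []
pmul (a ∷ p) q = padd (pscale a q) (0ℚ ∷ pmul p q)

pone : Poly
pone = 1ℚ ∷ []

pX : Poly
pX = 0ℚ ∷ 1ℚ ∷ []

pXminus : ℚ → Poly
pXminus c = (- c) ∷ 1ℚ ∷ []

ppow : Poly → ℕ → Poly
ppow p zero    = pone
ppow p (suc k) = pmul p (ppow p k)

peval : Poly → ℚ → ℚ
peval []      x = 0ℚ
peval (a ∷ p) x = a + x * peval p x

antideriv-from : ℕ → Poly → Poly
antideriv-from k []      = []
antideriv-from k (a ∷ p) = (a * ((+ 1) / suc k)) ∷ antideriv-from (suc k) p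

antideriv : Poly → Poly
antideriv p = 0ℚ ∷ antideriv-from 0 p

-- Definite integral ∫_a^b p(x) dx of a polynomial (fundamental theorem of calculus)
∫[_,_]_ : ℚ → ℚ → Poly → ℚ
∫[ a , b ] p = peval (antideriv p) b - peval (antideriv p) a

-- ∫_0^n (x-i)_+^{n-1} x^m dx.  Since (x-i)_+ vanishes for x ≤ i, this is
-- ∫_i^n (x-i)^{n-1} x^m dx for i ≤ n (the only case used), and 0 if i ≥ n.
truncInt : (n i m : ℕ) → ℚ
truncInt n i m with i ℕ.≤ᵇ n
... | true  = ∫[ ℕtoℚ i , ℕtoℚ n ] pmul (ppow (pXminus (ℕtoℚ i)) (n ℕ.∸ 1)) (ppow pX m)
... | false = 0ℚ

LHS : ℕ → ℕ → ℚ
LHS n m = fact-ratio 0 (n ℕ.∸ 1) *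
  Σ0to n (λ i → ((- 1ℚ) ^ℚ i) * ℕtoℚ (n C i) * truncInt n i m)

RHS : ℕ → ℕ → ℚ
RHS n m = fact-ratio m (m ℕ.+ n) *
  Σ0to n (λ i → ((- 1ℚ) ^ℚ (n ℕ.∸ i)) * ℕtoℚ (n C i) * (ℕtoℚ i ^ℚ (m ℕ.+ n)))

{-# OPTIONS --safe #-}
module Submission where

-- For fixed t, F(c, t) = ∫₀ᵗ (x - c)ⁿ⁻¹ xᵐ dx = tᵐ⁺¹ ∫₀¹ xᵐ (t x - c)ⁿ⁻¹ dx is a polynomial of
-- degree n - 1 in c, so the n-th finite difference Σᵢ (-1)ⁱ C(n,i) F(i, n) vanishes.  The
-- integral on the left is F(i, n) - F(i, i), and by homogeneity F(i, i) = iᵐ⁺ⁿ B with the Beta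
-- integral B = ∫₀¹ xᵐ (x - 1)ⁿ⁻¹ dx = (-1)ⁿ⁻¹ (n-1)! m! / (m+n)!.  So the left side is
-- -B/(n-1)! · Σᵢ (-1)ⁱ C(n,i) iᵐ⁺ⁿ, which is the right side.

open import Defs
open import Data.Nat as ℕ using (ℕ; zero; suc; _!; z≤n; _≤_)
open import Data.Nat.Properties using (_!≢0)
import Data.Nat.Properties as ℕ
open import Data.Nat.Combinatorics using (_C_; nCk+nC[k+1]≡[n+1]C[k+1]; k>n⇒nCk≡0)
open import Data.Integer as ℤ using (+_)
import Data.Integer.Properties as ℤ
open import Data.List using ([]; _∷_)
open import Data.Bool using (true)
open import Data.Rational as ℚ using (ℚ; 0ℚ; 1ℚ; _+_; _*_; _-_; -_; _/_)
open import Data.Rational.Properties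
  using (toℚᵘ-injective; toℚᵘ-fromℚᵘ; toℚᵘ-homo-+; toℚᵘ-homo-*;
         +-identityˡ; +-identityʳ; +-inverseʳ; +-assoc; *-distribˡ-+; *-identityˡ; *-identityʳ; *-zeroˡ; *-zeroʳ; *-assoc)
import Data.Rational.Unnormalised as ℚᵘ
import Data.Rational.Unnormalised.Properties as ℚᵘ
open import Data.Rational.Solver using (module +-*-Solver)
open +-*-Solver using (solve; _:=_; _:+_; _:*_; _:-_; :-_; con)
open import Relation.Binary.PropositionalEquality
open ≡-Reasoning

toℚᵘ-ℕtoℚ : ∀ a → ℚ.toℚᵘ (ℕtoℚ a) ℚᵘ.≃ ℚᵘ.mkℚᵘ (+ a) 0
toℚᵘ-ℕtoℚ a = toℚᵘ-fromℚᵘ (ℚᵘ.mkℚᵘ (+ a) 0)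

ℕtoℚ-+ : ∀ a b → ℕtoℚ (a ℕ.+ b) ≡ ℕtoℚ a + ℕtoℚ b
ℕtoℚ-+ a b = toℚᵘ-injective (ℚᵘ.≃-trans (toℚᵘ-ℕtoℚ (a ℕ.+ b)) (ℚᵘ.≃-sym
  (ℚᵘ.≃-trans (toℚᵘ-homo-+ (ℕtoℚ a) (ℕtoℚ b))
    (ℚᵘ.≃-trans (ℚᵘ.+-cong (toℚᵘ-ℕtoℚ a) (toℚᵘ-ℕtoℚ b)) (ℚᵘ.*≡* numerators)))))
  where
  numerators : (+ a ℤ.* + 1 ℤ.+ + b ℤ.* + 1) ℤ.* + 1 ≡ + (a ℕ.+ b) ℤ.* + 1
  numerators rewrite ℤ.*-identityʳ (+ a) | ℤ.*-identityʳ (+ b) | ℤ.*-identityʳ (+ a ℤ.+ + b)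
    = sym (ℤ.pos-+ a b)

ℕtoℚ-* : ∀ a b → ℕtoℚ (a ℕ.* b) ≡ ℕtoℚ a * ℕtoℚ b
ℕtoℚ-* a b = toℚᵘ-injective (ℚᵘ.≃-trans (toℚᵘ-ℕtoℚ (a ℕ.* b)) (ℚᵘ.≃-sym
  (ℚᵘ.≃-trans (toℚᵘ-homo-* (ℕtoℚ a) (ℕtoℚ b))
    (ℚᵘ.≃-trans (ℚᵘ.*-cong (toℚᵘ-ℕtoℚ a) (toℚᵘ-ℕtoℚ b)) (ℚᵘ.*≡* numerators)))))
  where
  numerators : (+ a ℤ.* + b) ℤ.* + 1 ≡ + (a ℕ.* b) ℤ.* + 1
  numerators = cong (ℤ._* + 1) (sym (ℤ.pos-* a b))

ℕtoℚ-suc : ∀ a → ℕtoℚ (suc a) ≡ 1ℚ + ℕtoℚ a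
ℕtoℚ-suc = ℕtoℚ-+ 1

ℕtoℚ-*-/ : ∀ a d .{{_ : ℕ.NonZero d}} → ℕtoℚ d * (+ a / d) ≡ ℕtoℚ a
ℕtoℚ-*-/ a (suc e) = toℚᵘ-injective (ℚᵘ.≃-trans (toℚᵘ-homo-* (ℕtoℚ (suc e)) (+ a / suc e))
  (ℚᵘ.≃-trans (ℚᵘ.*-cong (toℚᵘ-ℕtoℚ (suc e)) (toℚᵘ-fromℚᵘ (ℚᵘ.mkℚᵘ (+ a) e)))
    (ℚᵘ.≃-trans (ℚᵘ.*≡* numerators) (ℚᵘ.≃-sym (toℚᵘ-ℕtoℚ a)))))
  where
  numerators : (+ suc e ℤ.* + a) ℤ.* + 1 ≡ + a ℤ.* + suc (e ℕ.+ 0)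
  numerators rewrite ℕ.+-identityʳ e | ℤ.*-identityʳ (+ suc e ℤ.* + a) = ℤ.*-comm (+ suc e) (+ a)

/-split : ∀ a d .{{_ : ℕ.NonZero d}} → + a / d ≡ ℕtoℚ a * (+ 1 / d)
/-split a (suc e) = toℚᵘ-injective (ℚᵘ.≃-trans (toℚᵘ-fromℚᵘ (ℚᵘ.mkℚᵘ (+ a) e)) (ℚᵘ.≃-sym
  (ℚᵘ.≃-trans (toℚᵘ-homo-* (ℕtoℚ a) (+ 1 / suc e))
    (ℚᵘ.≃-trans (ℚᵘ.*-cong (toℚᵘ-ℕtoℚ a) (toℚᵘ-fromℚᵘ (ℚᵘ.mkℚᵘ (+ 1) e))) (ℚᵘ.*≡* numerators)))))
  where
  numerators : (+ a ℤ.* + 1) ℤ.* + suc e ≡ + a ℤ.* + suc (e ℕ.+ 0)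
  numerators rewrite ℕ.+-identityʳ e | ℤ.*-identityʳ (+ a) = refl

^ℚ-+ : ∀ c a b → c ^ℚ (a ℕ.+ b) ≡ c ^ℚ a * c ^ℚ b
^ℚ-+ c zero    b = sym (*-identityˡ _)
^ℚ-+ c (suc a) b = trans (cong (c *_) (^ℚ-+ c a b)) (sym (*-assoc c _ _))

-1^d≡-1^[i+d]*-1^i : ∀ i d → (- 1ℚ) ^ℚ d ≡ (- 1ℚ) ^ℚ (i ℕ.+ d) * (- 1ℚ) ^ℚ i
-1^d≡-1^[i+d]*-1^i zero    d = sym (*-identityʳ _)
-1^d≡-1^[i+d]*-1^i (suc i) d = trans (-1^d≡-1^[i+d]*-1^i i d)
  (solve 2 (λ x y → x :* y := (con (- 1ℚ) :* x) :* (con (- 1ℚ) :* y)) refl ((- 1ℚ) ^ℚ (i ℕ.+ d)) ((- 1ℚ) ^ℚ i))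

-1^[n∸i]≡-1^n*-1^i : ∀ n i → i ≤ n → (- 1ℚ) ^ℚ (n ℕ.∸ i) ≡ (- 1ℚ) ^ℚ n * (- 1ℚ) ^ℚ i
-1^[n∸i]≡-1^n*-1^i n i i≤n = trans (-1^d≡-1^[i+d]*-1^i i (n ℕ.∸ i))
  (cong (λ k → (- 1ℚ) ^ℚ k * (- 1ℚ) ^ℚ i) (ℕ.m+[n∸m]≡n i≤n))

Σ0to-cong : ∀ n {f g : ℕ → ℚ} → (∀ i → i ≤ n → f i ≡ g i) → Σ0to n f ≡ Σ0to n g
Σ0to-cong zero    f≗g = f≗g 0 z≤n
Σ0to-cong (suc n) f≗g = cong₂ _+_ (Σ0to-cong n (λ i i≤n → f≗g i (ℕ.m≤n⇒m≤1+n i≤n))) (f≗g (suc n) ℕ.≤-refl)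

Σ0to-distrib-- : ∀ n (f g : ℕ → ℚ) → Σ0to n (λ i → f i - g i) ≡ Σ0to n f - Σ0to n g
Σ0to-distrib-- zero    f g = refl
Σ0to-distrib-- (suc n) f g = begin
  Σ0to n (λ i → f i - g i) + (f (suc n) - g (suc n))
    ≡⟨ cong (_+ (f (suc n) - g (suc n))) (Σ0to-distrib-- n f g) ⟩
  (Σ0to n f - Σ0to n g) + (f (suc n) - g (suc n))
    ≡⟨ solve 4 (λ a b c d → (a :- b) :+ (c :- d) := (a :+ c) :- (b :+ d)) refl (Σ0to n f) (Σ0to n g) (f (suc n)) (g (suc n)) ⟩
  (Σ0to n f + f (suc n)) - (Σ0to n g + g (suc n)) ∎

Σ0to-*ˡ : ∀ n c (f : ℕ → ℚ) → Σ0to n (λ i → c * f i) ≡ c * Σ0to n f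
Σ0to-*ˡ zero    c f = refl
Σ0to-*ˡ (suc n) c f = trans (cong (_+ c * f (suc n)) (Σ0to-*ˡ n c f)) (sym (*-distribˡ-+ c _ _))

Σ0to-suc : ∀ n (f : ℕ → ℚ) → Σ0to (suc n) f ≡ f 0 + Σ0to n (λ i → f (suc i))
Σ0to-suc zero    f = refl
Σ0to-suc (suc n) f = trans (cong (_+ f (suc (suc n))) (Σ0to-suc n f)) (+-assoc (f 0) _ _)

altBinomial : ℕ → ℕ → ℚ
altBinomial n i = (- 1ℚ) ^ℚ i * ℕtoℚ (n C i)

altBinomialSum : ℕ → (ℕ → ℚ) → ℚ
altBinomialSum n f = Σ0to n (λ i → altBinomial n i * f i)

altBinomial-suc : ∀ n i → altBinomial (suc n) (suc i) ≡ altBinomial n (suc i) - altBinomial n i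
altBinomial-suc n i = begin
  (- 1ℚ) * s * ℕtoℚ (suc n C suc i)                ≡⟨ cong (λ k → (- 1ℚ) * s * ℕtoℚ k) (sym (nCk+nC[k+1]≡[n+1]C[k+1] n i)) ⟩
  (- 1ℚ) * s * ℕtoℚ (n C i ℕ.+ n C suc i)          ≡⟨ cong ((- 1ℚ) * s *_) (ℕtoℚ-+ (n C i) (n C suc i)) ⟩
  (- 1ℚ) * s * (ℕtoℚ (n C i) + ℕtoℚ (n C suc i))   ≡⟨ solve 3 (λ s a b → (con (- 1ℚ) :* s) :* (a :+ b) := (con (- 1ℚ) :* s) :* b :- s :* a) refl s (ℕtoℚ (n C i)) (ℕtoℚ (n C suc i)) ⟩
  (- 1ℚ) * s * ℕtoℚ (n C suc i) - s * ℕtoℚ (n C i) ∎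
  where
  s : ℚ
  s = (- 1ℚ) ^ℚ i

altBinomialSum-distrib-- : ∀ n (f g : ℕ → ℚ) → altBinomialSum n (λ i → f i - g i) ≡ altBinomialSum n f - altBinomialSum n g
altBinomialSum-distrib-- n f g = trans
  (Σ0to-cong n (λ i _ → solve 3 (λ w x y → w :* (x :- y) := w :* x :- w :* y) refl (altBinomial n i) (f i) (g i)))
  (Σ0to-distrib-- n _ _)

altBinomialSum-*ˡ : ∀ n c (f : ℕ → ℚ) → altBinomialSum n (λ i → c * f i) ≡ c * altBinomialSum n f
altBinomialSum-*ˡ n c f = trans
  (Σ0to-cong n (λ i _ → solve 3 (λ w c x → w :* (c :* x) := c :* (w :* x)) refl (altBinomial n i) c (f i)))
  (Σ0to-*ˡ n c _)

altBinomial-beyond : ∀ n → altBinomial n (suc n) ≡ 0ℚ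
altBinomial-beyond n = trans (cong (λ k → (- 1ℚ) ^ℚ suc n * ℕtoℚ k) (k>n⇒nCk≡0 (ℕ.n<1+n n))) (*-zeroʳ ((- 1ℚ) ^ℚ suc n))

altBinomialSum-suc-split : ∀ n f → altBinomialSum (suc n) f ≡ altBinomialSum n f - altBinomialSum n (λ i → f (suc i))
altBinomialSum-suc-split n f = begin
  altBinomialSum (suc n) f
    ≡⟨ Σ0to-suc n _ ⟩
  w 0 * f 0 + Σ0to n (λ i → altBinomial (suc n) (suc i) * f (suc i))
    ≡⟨ cong (_+_ (w 0 * f 0)) (Σ0to-cong n (λ i _ → trans (cong (_* f (suc i)) (altBinomial-suc n i))
         (solve 3 (λ a b x → (a :- b) :* x := a :* x :- b :* x) refl (w (suc i)) (w i) (f (suc i))))) ⟩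
  w 0 * f 0 + Σ0to n (λ i → w (suc i) * f (suc i) - w i * f (suc i))
    ≡⟨ cong (_+_ (w 0 * f 0)) (Σ0to-distrib-- n _ _) ⟩
  w 0 * f 0 + (Σ0to n (λ i → w (suc i) * f (suc i)) - D⁺)
    ≡⟨ sym (+-assoc (w 0 * f 0) _ _) ⟩
  (w 0 * f 0 + Σ0to n (λ i → w (suc i) * f (suc i))) - D⁺
    ≡⟨ cong (_- D⁺) (sym (Σ0to-suc n (λ i → w i * f i))) ⟩
  (altBinomialSum n f + w (suc n) * f (suc n)) - D⁺
    ≡⟨ cong (λ x → (altBinomialSum n f + x * f (suc n)) - D⁺) (altBinomial-beyond n) ⟩
  (altBinomialSum n f + 0ℚ * f (suc n)) - D⁺
    ≡⟨ solve 3 (λ a x b → (a :+ con 0ℚ :* x) :- b := a :- b) refl (altBinomialSum n f) (f (suc n)) D⁺ ⟩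
  altBinomialSum n f - D⁺ ∎
  where
  w : ℕ → ℚ
  w = altBinomial n
  D⁺ : ℚ
  D⁺ = altBinomialSum n (λ i → f (suc i))

Δ : (ℕ → ℚ) → ℕ → ℚ
Δ f c = f c - f (suc c)

altBinomialSum-Δ : ∀ n f → altBinomialSum (suc n) f ≡ altBinomialSum n (Δ f)
altBinomialSum-Δ n f = trans (altBinomialSum-suc-split n f) (sym (altBinomialSum-distrib-- n f (λ i → f (suc i))))

data DegreeBelow : ℕ → (ℕ → ℚ) → Set where
  vanish : ∀ {f} → (∀ c → f c ≡ 0ℚ) → DegreeBelow zero f
  fromΔ  : ∀ {k f} → DegreeBelow k (Δ f) → DegreeBelow (suc k) f

DegreeBelow-cong : ∀ {k f g} → (∀ c → f c ≡ g c) → DegreeBelow k f → DegreeBelow k g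
DegreeBelow-cong f≗g (vanish f≗0) = vanish (λ c → trans (sym (f≗g c)) (f≗0 c))
DegreeBelow-cong f≗g (fromΔ df)   = fromΔ (DegreeBelow-cong (λ c → cong₂ _-_ (f≗g c) (f≗g (suc c))) df)

DegreeBelow-suc : ∀ {k f} → DegreeBelow k f → DegreeBelow (suc k) f
DegreeBelow-suc (vanish f≗0) = fromΔ (vanish (λ c → cong₂ _-_ (f≗0 c) (f≗0 (suc c))))
DegreeBelow-suc (fromΔ df)   = fromΔ (DegreeBelow-suc df)

DegreeBelow-const : ∀ k a → DegreeBelow (suc k) (λ _ → a)
DegreeBelow-const zero    a = fromΔ (vanish (λ _ → +-inverseʳ a))
DegreeBelow-const (suc k) a = DegreeBelow-suc (DegreeBelow-const k a)

DegreeBelow-+ : ∀ {k f g} → DegreeBelow k f → DegreeBelow k g → DegreeBelow k (λ c → f c + g c)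
DegreeBelow-+ (vanish f≗0) (vanish g≗0) = vanish (λ c → cong₂ _+_ (f≗0 c) (g≗0 c))
DegreeBelow-+ {f = f} {g} (fromΔ df) (fromΔ dg) = fromΔ (DegreeBelow-cong
  (λ c → solve 4 (λ a b x y → (a :- x) :+ (b :- y) := (a :+ b) :- (x :+ y)) refl (f c) (g c) (f (suc c)) (g (suc c)))
  (DegreeBelow-+ df dg))

DegreeBelow-*ˡ : ∀ {k f} a → DegreeBelow k f → DegreeBelow k (λ c → a * f c)
DegreeBelow-*ˡ a (vanish f≗0) = vanish (λ c → trans (cong (a *_) (f≗0 c)) (*-zeroʳ a))
DegreeBelow-*ˡ {f = f} a (fromΔ df) = fromΔ (DegreeBelow-cong
  (λ c → solve 3 (λ a x y → a :* (x :- y) := a :* x :- a :* y) refl a (f c) (f (suc c)))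
  (DegreeBelow-*ˡ a df))

DegreeBelow-shift : ∀ {k f} → DegreeBelow k f → DegreeBelow k (λ c → f (suc c))
DegreeBelow-shift (vanish f≗0) = vanish (λ c → f≗0 (suc c))
DegreeBelow-shift (fromΔ df)   = fromΔ (DegreeBelow-shift df)

DegreeBelow-*id : ∀ {k f} → DegreeBelow k f → DegreeBelow (suc k) (λ c → ℕtoℚ c * f c)
DegreeBelow-*id (vanish f≗0) = DegreeBelow-suc (vanish (λ c → trans (cong (ℕtoℚ c *_) (f≗0 c)) (*-zeroʳ (ℕtoℚ c))))
DegreeBelow-*id {f = f} (fromΔ df) = fromΔ (DegreeBelow-cong Δ[id*f]
  (DegreeBelow-+ (DegreeBelow-*id df) (DegreeBelow-*ˡ (- 1ℚ) (DegreeBelow-shift {f = f} (fromΔ df)))))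
  where
  Δ[id*f] : ∀ c → ℕtoℚ c * Δ f c + (- 1ℚ) * f (suc c) ≡ ℕtoℚ c * f c - ℕtoℚ (suc c) * f (suc c)
  Δ[id*f] c rewrite ℕtoℚ-suc c =
    solve 3 (λ x a b → x :* (a :- b) :+ con (- 1ℚ) :* b := x :* a :- (con 1ℚ :+ x) :* b) refl (ℕtoℚ c) (f c) (f (suc c))

altBinomialSum-DegreeBelow : ∀ {n f} → DegreeBelow n f → altBinomialSum n f ≡ 0ℚ
altBinomialSum-DegreeBelow (vanish f≗0) = trans (cong (1ℚ *_) (f≗0 0)) (*-zeroʳ 1ℚ)
altBinomialSum-DegreeBelow {suc n} {f} (fromΔ df) = trans (altBinomialSum-Δ n f) (altBinomialSum-DegreeBelow df)

1/suc : ℕ → ℚ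
1/suc r = + 1 / suc r

-- moment r p t = Σⱼ pⱼ tʲ / (r + j + 1) = ∫₀¹ xʳ p(t x) dx
moment : ℕ → Poly → ℚ → ℚ
moment r p t = peval (antideriv-from r p) t

moment-padd : ∀ r p q t → moment r (padd p q) t ≡ moment r p t + moment r q t
moment-padd r []      q       t = sym (+-identityˡ _)
moment-padd r (a ∷ p) []      t = sym (+-identityʳ _)
moment-padd r (a ∷ p) (b ∷ q) t rewrite moment-padd (suc r) p q t =
  solve 6 (λ a b i t x y → (a :+ b) :* i :+ t :* (x :+ y) := (a :* i :+ t :* x) :+ (b :* i :+ t :* y))
    refl a b (1/suc r) t (moment (suc r) p t) (moment (suc r) q t)

moment-pscale : ∀ r c p t → moment r (pscale c p) t ≡ c * moment r p t
moment-pscale r c []      t = sym (*-zeroʳ c)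
moment-pscale r c (a ∷ p) t rewrite moment-pscale (suc r) c p t =
  solve 5 (λ c a i t x → (c :* a) :* i :+ t :* (c :* x) := c :* (a :* i :+ t :* x)) refl c a (1/suc r) t (moment (suc r) p t)

moment-pmul-∷ : ∀ r a p q t → moment r (pmul (a ∷ p) q) t ≡ a * moment r q t + t * moment (suc r) (pmul p q) t
moment-pmul-∷ r a p q t rewrite moment-padd r (pscale a q) (0ℚ ∷ pmul p q) t | moment-pscale r a q t =
  cong (_+_ (a * moment r q t)) (trans (cong (_+ t * moment (suc r) (pmul p q) t) (*-zeroˡ (1/suc r))) (+-identityˡ _))

moment-pone : ∀ r t → moment r pone t ≡ 1/suc r
moment-pone r t = solve 2 (λ i t → con 1ℚ :* i :+ t :* con 0ℚ := i) refl (1/suc r) t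

moment-pmul-linear : ∀ r a b q t → moment r (pmul (a ∷ b ∷ []) q) t ≡ a * moment r q t + b * (t * moment (suc r) q t)
moment-pmul-linear r a b q t rewrite moment-pmul-∷ r a (b ∷ []) q t | moment-pmul-∷ (suc r) b [] q t =
  solve 5 (λ a b t x y → a :* x :+ t :* (b :* y :+ t :* con 0ℚ) := a :* x :+ b :* (t :* y)) refl a b t (moment r q t) (moment (suc r) q t)

moment-Xᵐ : ∀ r m t → moment r (ppow pX m) t ≡ t ^ℚ m * 1/suc (r ℕ.+ m)
moment-Xᵐ r zero    t rewrite ℕ.+-identityʳ r = trans (moment-pone r t) (sym (*-identityˡ _))
moment-Xᵐ r (suc m) t = begin
  moment r (pmul pX (ppow pX m)) t                          ≡⟨ moment-pmul-linear r 0ℚ 1ℚ (ppow pX m) t ⟩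
  0ℚ * moment r (ppow pX m) t + 1ℚ * (t * moment (suc r) (ppow pX m) t)
    ≡⟨ cong (λ x → 0ℚ * moment r (ppow pX m) t + 1ℚ * (t * x)) (moment-Xᵐ (suc r) m t) ⟩
  0ℚ * moment r (ppow pX m) t + 1ℚ * (t * (t ^ℚ m * 1/suc (suc r ℕ.+ m)))
    ≡⟨ solve 4 (λ x t p i → con 0ℚ :* x :+ con 1ℚ :* (t :* (p :* i)) := (t :* p) :* i) refl (moment r (ppow pX m) t) t (t ^ℚ m) _ ⟩
  t ^ℚ suc m * 1/suc (suc (r ℕ.+ m))                        ≡⟨ cong (λ k → t ^ℚ suc m * 1/suc k) (sym (ℕ.+-suc r m)) ⟩
  t ^ℚ suc m * 1/suc (r ℕ.+ suc m)                          ∎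

moment-*Xᵐ : ∀ r p m t → moment r (pmul p (ppow pX m)) t ≡ t ^ℚ m * moment (r ℕ.+ m) p t
moment-*Xᵐ r []      m t = sym (*-zeroʳ (t ^ℚ m))
moment-*Xᵐ r (a ∷ p) m t
  rewrite moment-pmul-∷ r a p (ppow pX m) t | moment-Xᵐ r m t | moment-*Xᵐ (suc r) p m t =
  solve 5 (λ a s i t x → a :* (s :* i) :+ t :* (s :* x) := s :* (a :* i :+ t :* x))
    refl a (t ^ℚ m) (1/suc (r ℕ.+ m)) t (moment (suc (r ℕ.+ m)) p t)

-- betaIntegral c t k r = ∫₀¹ xʳ (t x - c)ᵏ dx
betaIntegral : ℚ → ℚ → ℕ → ℕ → ℚ
betaIntegral c t zero    r = 1/suc r
betaIntegral c t (suc k) r = (- c) * betaIntegral c t k r + t * betaIntegral c t k (suc r)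

moment-[X-c]ᵏ : ∀ r c k t → moment r (ppow (pXminus c) k) t ≡ betaIntegral c t k r
moment-[X-c]ᵏ r c zero    t = moment-pone r t
moment-[X-c]ᵏ r c (suc k) t rewrite moment-pmul-linear r (- c) 1ℚ (ppow (pXminus c) k) t
  | moment-[X-c]ᵏ r c k t | moment-[X-c]ᵏ (suc r) c k t =
  cong (_+_ ((- c) * betaIntegral c t k r)) (*-identityˡ _)

antideriv-[X-c]ᵏXᵐ : ∀ c k m t →
  peval (antideriv (pmul (ppow (pXminus c) k) (ppow pX m))) t ≡ t ^ℚ suc m * betaIntegral c t k m
antideriv-[X-c]ᵏXᵐ c k m t rewrite moment-*Xᵐ 0 (ppow (pXminus c) k) m t | moment-[X-c]ᵏ m c k t =
  trans (+-identityˡ _) (sym (*-assoc t _ _))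

betaIntegral-degree : ∀ t k r → DegreeBelow (suc k) (λ i → betaIntegral (ℕtoℚ i) t k r)
betaIntegral-degree t zero    r = DegreeBelow-const 0 (1/suc r)
betaIntegral-degree t (suc k) r = DegreeBelow-cong
  (λ i → solve 3 (λ c x y → con (- 1ℚ) :* (c :* x) :+ con t :* y := (:- c) :* x :+ con t :* y)
           refl (ℕtoℚ i) (betaIntegral (ℕtoℚ i) t k r) (betaIntegral (ℕtoℚ i) t k (suc r)))
  (DegreeBelow-+ (DegreeBelow-*ˡ (- 1ℚ) (DegreeBelow-*id (betaIntegral-degree t k r)))
                 (DegreeBelow-suc (DegreeBelow-*ˡ t (betaIntegral-degree t k (suc r)))))

beta : ℕ → ℕ → ℚ
beta = betaIntegral 1ℚ 1ℚ

betaIntegral-diagonal : ∀ c k r → betaIntegral c c k r ≡ c ^ℚ k * beta k r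
betaIntegral-diagonal c zero    r = sym (*-identityˡ (1/suc r))
betaIntegral-diagonal c (suc k) r rewrite betaIntegral-diagonal c k r | betaIntegral-diagonal c k (suc r) =
  solve 4 (λ c p b b' → (:- c) :* (p :* b) :+ c :* (p :* b') := (c :* p) :* ((:- con 1ℚ) :* b :+ con 1ℚ :* b'))
    refl c (c ^ℚ k) (beta k r) (beta k (suc r))

beta-suc : ∀ k r → beta (suc k) r ≡ beta k (suc r) - beta k r
beta-suc k r = solve 2 (λ b b' → (:- con 1ℚ) :* b :+ con 1ℚ :* b' := b' :- b) refl (beta k r) (beta k (suc r))

beta-closed : ∀ k r → beta k r * ℕtoℚ (suc (k ℕ.+ r) !) ≡ (- 1ℚ) ^ℚ k * (ℕtoℚ (k !) * ℕtoℚ (r !))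
beta-closed zero r = begin
  1/suc r * ℕtoℚ (suc r ℕ.* r !)             ≡⟨ cong (1/suc r *_) (ℕtoℚ-* (suc r) (r !)) ⟩
  1/suc r * (ℕtoℚ (suc r) * ℕtoℚ (r !))      ≡⟨ solve 3 (λ i s x → i :* (s :* x) := (s :* i) :* x) refl (1/suc r) (ℕtoℚ (suc r)) (ℕtoℚ (r !)) ⟩
  ℕtoℚ (suc r) * 1/suc r * ℕtoℚ (r !)        ≡⟨ cong (_* ℕtoℚ (r !)) (ℕtoℚ-*-/ 1 (suc r)) ⟩
  1ℚ * ℕtoℚ (r !)                            ≡⟨ cong (1ℚ *_) (sym (*-identityˡ (ℕtoℚ (r !)))) ⟩
  1ℚ * (1ℚ * ℕtoℚ (r !))                     ∎
beta-closed (suc k) r = begin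
  beta (suc k) r * ℕtoℚ (N ℕ.* F)
    ≡⟨ cong₂ _*_ (beta-suc k r) (ℕtoℚ-* N F) ⟩
  (beta k (suc r) - beta k r) * (ℕtoℚ N * ℕtoℚ F)
    ≡⟨ solve 4 (λ b' b n f → (b' :- b) :* (n :* f) := b' :* (n :* f) :- n :* (b :* f)) refl (beta k (suc r)) (beta k r) (ℕtoℚ N) (ℕtoℚ F) ⟩
  beta k (suc r) * (ℕtoℚ N * ℕtoℚ F) - ℕtoℚ N * (beta k r * ℕtoℚ F)
    ≡⟨ cong₂ (λ x y → x - ℕtoℚ N * y) IH₊ (beta-closed k r) ⟩
  s * (K * ℕtoℚ (suc r ℕ.* r !)) - ℕtoℚ N * (s * (K * R))
    ≡⟨ cong₂ (λ x y → s * (K * x) - y * (s * (K * R))) (trans (ℕtoℚ-* (suc r) (r !)) (cong (_* R) (ℕtoℚ-suc r))) N≡ ⟩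
  s * (K * ((1ℚ + ℕtoℚ r) * R)) - (1ℚ + (1ℚ + (ℕtoℚ k + ℕtoℚ r))) * (s * (K * R))
    ≡⟨ solve 5 (λ x y s K R → s :* (K :* ((con 1ℚ :+ y) :* R)) :- (con 1ℚ :+ (con 1ℚ :+ (x :+ y))) :* (s :* (K :* R))
                 := (con (- 1ℚ) :* s) :* (((con 1ℚ :+ x) :* K) :* R)) refl (ℕtoℚ k) (ℕtoℚ r) s K R ⟩
  (- 1ℚ) * s * ((1ℚ + ℕtoℚ k) * K * R)
    ≡⟨ cong (λ x → (- 1ℚ) * s * (x * R)) (trans (cong (_* K) (sym (ℕtoℚ-suc k))) (sym (ℕtoℚ-* (suc k) (k !)))) ⟩
  (- 1ℚ) ^ℚ suc k * (ℕtoℚ (suc k !) * R) ∎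
  where
  N F : ℕ
  N = suc (suc (k ℕ.+ r))
  F = suc (k ℕ.+ r) !
  s K R : ℚ
  s = (- 1ℚ) ^ℚ k
  K = ℕtoℚ (k !)
  R = ℕtoℚ (r !)
  IH₊ : beta k (suc r) * (ℕtoℚ N * ℕtoℚ F) ≡ s * (K * ℕtoℚ (suc r !))
  IH₊ = trans (cong (λ j → beta k (suc r) * j) (trans (sym (ℕtoℚ-* N F)) (cong (λ j → ℕtoℚ (suc j !)) (sym (ℕ.+-suc k r)))))
              (beta-closed k (suc r))
  N≡ : ℕtoℚ N ≡ 1ℚ + (1ℚ + (ℕtoℚ k + ℕtoℚ r))
  N≡ rewrite ℕtoℚ-suc (suc (k ℕ.+ r)) | ℕtoℚ-suc (k ℕ.+ r) | ℕtoℚ-+ k r = refl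

x*d≡y⇒x≡y*1/d : ∀ {x y} d .{{_ : ℕ.NonZero d}} → x * ℕtoℚ d ≡ y → x ≡ y * (+ 1 / d)
x*d≡y⇒x≡y*1/d {x} {y} d x*d≡y = begin
  x                         ≡⟨ sym (*-identityʳ x) ⟩
  x * 1ℚ                    ≡⟨ cong (x *_) (sym (ℕtoℚ-*-/ 1 d)) ⟩
  x * (ℕtoℚ d * (+ 1 / d))  ≡⟨ sym (*-assoc x _ _) ⟩
  x * ℕtoℚ d * (+ 1 / d)    ≡⟨ cong (_* (+ 1 / d)) x*d≡y ⟩
  y * (+ 1 / d)             ∎

beta-fact-ratio : ∀ k r → beta k r ≡ (- 1ℚ) ^ℚ k * ℕtoℚ (k !) * fact-ratio r (r ℕ.+ suc k)
beta-fact-ratio k r = begin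
  beta k r
    ≡⟨ x*d≡y⇒x≡y*1/d ((r ℕ.+ suc k) !) (trans (cong (λ j → beta k r * ℕtoℚ (j !)) (sym k+r≡r+k)) (beta-closed k r)) ⟩
  (- 1ℚ) ^ℚ k * (ℕtoℚ (k !) * ℕtoℚ (r !)) * (+ 1 / (r ℕ.+ suc k) !)
    ≡⟨ solve 4 (λ s K R i → s :* (K :* R) :* i := s :* K :* (R :* i)) refl ((- 1ℚ) ^ℚ k) (ℕtoℚ (k !)) (ℕtoℚ (r !)) _ ⟩
  (- 1ℚ) ^ℚ k * ℕtoℚ (k !) * (ℕtoℚ (r !) * (+ 1 / (r ℕ.+ suc k) !))
    ≡⟨ cong ((- 1ℚ) ^ℚ k * ℕtoℚ (k !) *_) (sym (/-split (r !) ((r ℕ.+ suc k) !))) ⟩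
  (- 1ℚ) ^ℚ k * ℕtoℚ (k !) * fact-ratio r (r ℕ.+ suc k) ∎
  where
  instance
    [r+1+k]!≢0 : ℕ.NonZero ((r ℕ.+ suc k) !)
    [r+1+k]!≢0 = (r ℕ.+ suc k) !≢0
  k+r≡r+k : suc (k ℕ.+ r) ≡ r ℕ.+ suc k
  k+r≡r+k = trans (cong suc (ℕ.+-comm k r)) (sym (ℕ.+-suc r k))

truncInt-≤ : ∀ {n i} m → i ≤ n →
  truncInt n i m ≡ ∫[ ℕtoℚ i , ℕtoℚ n ] pmul (ppow (pXminus (ℕtoℚ i)) (n ℕ.∸ 1)) (ppow pX m)
truncInt-≤ {n} {i} m i≤n with i ℕ.≤ᵇ n | ℕ.≤⇒≤ᵇ i≤n
... | true | _ = refl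

altBinomialSum-truncInt : ∀ k m →
  altBinomialSum (suc k) (λ i → truncInt (suc k) i m) ≡ 0ℚ - beta k m * altBinomialSum (suc k) (λ i → ℕtoℚ i ^ℚ (m ℕ.+ suc k))
altBinomialSum-truncInt k m = begin
  altBinomialSum n (λ i → truncInt n i m)
    ≡⟨ Σ0to-cong n (λ i i≤n → cong (altBinomial n i *_) (trans (truncInt-≤ m i≤n)
         (cong₂ _-_ (antideriv-[X-c]ᵏXᵐ (ℕtoℚ i) k m (ℕtoℚ n)) (antideriv-[X-c]ᵏXᵐ (ℕtoℚ i) k m (ℕtoℚ i))))) ⟩
  altBinomialSum n (λ i → G (ℕtoℚ n) (ℕtoℚ i) - G (ℕtoℚ i) (ℕtoℚ i))
    ≡⟨ altBinomialSum-distrib-- n _ _ ⟩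
  altBinomialSum n (λ i → G (ℕtoℚ n) (ℕtoℚ i)) - altBinomialSum n (λ i → G (ℕtoℚ i) (ℕtoℚ i))
    ≡⟨ cong₂ _-_ (altBinomialSum-DegreeBelow (DegreeBelow-*ˡ (ℕtoℚ n ^ℚ suc m) (betaIntegral-degree (ℕtoℚ n) k m)))
                 (Σ0to-cong n (λ i _ → cong (altBinomial n i *_) (G-diagonal (ℕtoℚ i)))) ⟩
  0ℚ - altBinomialSum n (λ i → beta k m * ℕtoℚ i ^ℚ (m ℕ.+ n))
    ≡⟨ cong (_-_ 0ℚ) (altBinomialSum-*ˡ n (beta k m) _) ⟩
  0ℚ - beta k m * altBinomialSum n (λ i → ℕtoℚ i ^ℚ (m ℕ.+ n)) ∎
  where
  n : ℕ
  n = suc k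
  G : ℚ → ℚ → ℚ
  G t c = t ^ℚ suc m * betaIntegral c t k m
  G-diagonal : ∀ c → G c c ≡ beta k m * c ^ℚ (m ℕ.+ n)
  G-diagonal c = begin
    c ^ℚ suc m * betaIntegral c c k m  ≡⟨ cong (c ^ℚ suc m *_) (betaIntegral-diagonal c k m) ⟩
    c ^ℚ suc m * (c ^ℚ k * beta k m)   ≡⟨ solve 3 (λ x y b → x :* (y :* b) := b :* (x :* y)) refl (c ^ℚ suc m) (c ^ℚ k) (beta k m) ⟩
    beta k m * (c ^ℚ suc m * c ^ℚ k)   ≡⟨ cong (beta k m *_) (trans (sym (^ℚ-+ c (suc m) k)) (cong (c ^ℚ_) (sym (ℕ.+-suc m k)))) ⟩
    beta k m * c ^ℚ (m ℕ.+ n)          ∎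

altBinomialSum-reversed : ∀ n f → Σ0to n (λ i → (- 1ℚ) ^ℚ (n ℕ.∸ i) * ℕtoℚ (n C i) * f i) ≡ (- 1ℚ) ^ℚ n * altBinomialSum n f
altBinomialSum-reversed n f = trans (Σ0to-cong n (λ i i≤n → trans (cong (λ s → s * ℕtoℚ (n C i) * f i) (-1^[n∸i]≡-1^n*-1^i n i i≤n))
  (solve 4 (λ a b c x → a :* b :* c :* x := a :* (b :* c :* x)) refl ((- 1ℚ) ^ℚ n) ((- 1ℚ) ^ℚ i) (ℕtoℚ (n C i)) (f i))))
  (Σ0to-*ˡ n ((- 1ℚ) ^ℚ n) _)

lemma4p4 : (n m : ℕ) → 1 ≤ n → 1 ≤ m → LHS n m ≡ RHS n m
lemma4p4 (suc k) m _ _ = begin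
  a * altBinomialSum n (λ i → truncInt n i m)     ≡⟨ cong (a *_) (altBinomialSum-truncInt k m) ⟩
  a * (0ℚ - beta k m * S)                         ≡⟨ cong (λ x → a * (0ℚ - x * S)) (beta-fact-ratio k m) ⟩
  a * (0ℚ - (- 1ℚ) ^ℚ k * K * b * S)
    ≡⟨ solve 5 (λ a s K b S → a :* (con 0ℚ :- s :* K :* b :* S) := (K :* a) :* (b :* ((con (- 1ℚ) :* s) :* S))) refl a ((- 1ℚ) ^ℚ k) K b S ⟩
  K * a * (b * ((- 1ℚ) ^ℚ n * S))                 ≡⟨ cong₂ _*_ (ℕtoℚ-*-/ 1 (k !)) (cong (b *_) (sym (altBinomialSum-reversed n _))) ⟩
  1ℚ * RHS n m                                    ≡⟨ *-identityˡ _ ⟩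
  RHS n m                                         ∎
  where
  instance
    k!≢0 : ℕ.NonZero (k !)
    k!≢0 = k !≢0
  n : ℕ
  n = suc k
  a b K S : ℚ
  a = fact-ratio 0 k
  b = fact-ratio m (m ℕ.+ n)
  K = ℕtoℚ (k !)
  S = altBinomialSum n (λ i → ℕtoℚ i ^ℚ (m ℕ.+ n))
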